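{- Suppose there exists a strongly regular graph with parameters $(n_0,t,\lambda,\mu)$, and let $$k_0=\max\{n_0-t,\ t,\ n_0-2t+2\lambda+3,\ n_0-2t+2\mu-1,\ 2t-2\lambda-1,\ 2t-2\mu+2\}.$$ If $k_0\le n_0$, then for every $i=0,1,\dots,n_0+1$ there exists a graph in $\mathfrak{Gr}(n_0+i,k_0+i)$.
   Context: All graphs are finite, simple and undirected. A graph is strongly regular with parameters $(n,t,\lambda,\mu)$ if it has $n$ vertices, every vertex has degree $t$, any two adjacent vertices have exactly $\lambda$ common neighbours, and any two distinct nonadjacent vertices have exactly $\mu$ common neighbours. For a graph $G=(V,E)$ and $x\in V$, $N[x]=\{x\}\cup\{y: xy\in E\}$. A set $C\subseteq V$ is identifying if $N[x]\cap C\ne\emptyset$ for every $x\in V$ and $N[x]\cap C\neq N[y]\cap C$ for all distinct $x,y\in V$. For $n\ge k\ge1$, $\mathfrak{Gr}(n,k)$ is the set of graphs on $n$ vertices in which every $k$-element subset of vertices is identifying. -}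

module Defs where

open import Data.Nat using (ℕ; zero; suc; _+_; _*_; _∸_; _⊔_; _≤_)
open import Data.Bool using (Bool; true; false; _∧_; _∨_; if_then_else_)
open import Data.Fin using (Fin; zero; suc)
open import Data.Fin.Properties using (_≟_)
open import Data.Fin.Subset using (Subset; _∈_; ∣_∣)
open import Relation.Nullary using (¬_)
open import Relation.Nullary.Decidable using (⌊_⌋)
open import Relation.Binary.PropositionalEquality using (_≡_; _≢_)
open import Data.Product using (Σ; ∃; _×_)

record Graph (n : ℕ) : Set where
  field
    adj    : Fin n → Fin n → Bool
    sym    : ∀ x y → adj x y ≡ adj y x
    irrefl : ∀ x → adj x x ≡ false
open Graph public

count : {n : ℕ} → (Fin n → Bool) → ℕ
count {zero}  p = 0
count {suc n} p = (if p zero then 1 else 0) + count (λ z → p (suc z))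

degree : {n : ℕ} → Graph n → Fin n → ℕ
degree G x = count (adj G x)

commonNeighbours : {n : ℕ} → Graph n → Fin n → Fin n → ℕ
commonNeighbours G x y = count (λ z → adj G x z ∧ adj G y z)

IsStronglyRegular : {n : ℕ} → Graph n → (t λ' μ : ℕ) → Set
IsStronglyRegular G t λ' μ =
  (∀ x → degree G x ≡ t)
  × (∀ x y → x ≢ y → adj G x y ≡ true → commonNeighbours G x y ≡ λ')
  × (∀ x y → x ≢ y → adj G x y ≡ false → commonNeighbours G x y ≡ μ)

SRGExists : (n t λ' μ : ℕ) → Set
SRGExists n t λ' μ = Σ (Graph n) λ G → IsStronglyRegular G t λ' μ

inN : {n : ℕ} → Graph n → Fin n → Fin n → Bool
inN G x y = ⌊ x ≟ y ⌋ ∨ adj G x y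

IsIdentifying : {n : ℕ} → Graph n → Subset n → Set
IsIdentifying {n} G C =
  (∀ x → ∃ λ y → y ∈ C × inN G x y ≡ true)
  × (∀ x y → x ≢ y → ¬ (∀ z → z ∈ C → inN G x z ≡ inN G y z))

InGr : (n k : ℕ) → Graph n → Set
InGr n k G = (1 ≤ k) × (k ≤ n) × (∀ (C : Subset n) → ∣ C ∣ ≡ k → IsIdentifying G C)

-- k₀ = max{n-t, t, n-2t+2λ+3, n-2t+2μ-1, 2t-2λ-1, 2t-2μ+2}
-- (truncated subtraction is harmless here since the max is ≥ t ≥ 0)
k₀ : (n t λ' μ : ℕ) → ℕ
k₀ n t λ' μ =
  (n ∸ t) ⊔ t
  ⊔ ((n + 2 * λ' + 3) ∸ (2 * t))
  ⊔ ((n + 2 * μ) ∸ (2 * t + 1))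
  ⊔ ((2 * t) ∸ (2 * λ' + 1))
  ⊔ ((2 * t + 2) ∸ (2 * μ))

-- A graph on N vertices lies in 𝔊𝔯(N, K) as soon as every closed neighbourhood N[u] and every
-- symmetric difference N[u] ∆ N[v] (u ≠ v) has more than N − K vertices, since a K-set can only
-- miss a set that fits into its complement.  From the strongly regular graph G on n vertices
-- we build a graph on n + i vertices by adding, for i distinct vertices x of G, a copy x′
-- adjacent to the copies of the neighbours of x and to the old vertices that are not
-- neighbours of x (x itself included), and, when i = n + 1, an apex adjacent exactly to the n
-- copies.  As N − K = n − k₀ does not depend on i, it suffices to count traces on the old
-- vertices, where strong regularity gives |N[x]| = t + 1 and |N[x] ∩ N[y]| ≤ λ + 2 or ≤ μ;
-- the terms of k₀ are exactly the resulting conditions for the various kinds of pairs.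

module Submission where

open import Defs hiding (sym)
open import Data.Bool using (Bool; true; false; _∧_; _∨_; not; _xor_; if_then_else_)
open import Data.Bool.Properties
  using (xor-comm; xor-identityʳ; xor-same; ∧-comm; ∧-distribʳ-∨; ∧-inverseʳ; ∨-zeroʳ; not-involutive)
open import Data.Empty using (⊥-elim)
open import Data.Fin using (Fin; zero; suc; _↑ˡ_; _↑ʳ_; splitAt; inject≤)
open import Data.Fin.Properties
  using (_≟_; splitAt-↑ˡ; splitAt-↑ʳ; splitAt⁻¹-↑ˡ; splitAt⁻¹-↑ʳ; ↑ˡ-injective; ↑ʳ-injective; inject≤-injective)
open import Data.Fin.Subset using (Subset; _∈_; ∣_∣)
open import Data.List using (_∷_; [])
open import Data.Nat using (ℕ; zero; suc; _+_; _*_; _∸_; _⊔_; _≤_; _≤?_; z≤n; s≤s)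
open import Data.Nat.Properties hiding (_≟_)
open import Data.Nat.Tactic.RingSolver using (solve)
open import Algebra.Properties.CommutativeSemigroup +-commutativeSemigroup using (interchange)
open import Data.Product using (Σ; ∃; _×_; _,_; proj₁; proj₂)
open import Data.Sum using (_⊎_; inj₁; inj₂; map₂)
open import Data.Vec.Base as Vec using (here; there)
open import Function using (_∘_)
open import Relation.Nullary using (¬_; yes; no)
open import Relation.Nullary.Decidable using (⌊_⌋)
open import Relation.Binary.PropositionalEquality

-- Counting

𝟙 : Bool → ℕ
𝟙 b = if b then 1 else 0

count-cong : ∀ {n} {p q : Fin n → Bool} → (∀ z → p z ≡ q z) → count p ≡ count q
count-cong {zero}  p≗q = refl
count-cong {suc n} p≗q = cong₂ _+_ (cong 𝟙 (p≗q zero)) (count-cong (p≗q ∘ suc))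

count-lift-≤ : ∀ {n} (p q r s : Fin n → Bool) →
  (∀ z → 𝟙 (p z) + 𝟙 (q z) ≤ 𝟙 (r z) + 𝟙 (s z)) →
  count p + count q ≤ count r + count s
count-lift-≤ {zero}  p q r s h = z≤n
count-lift-≤ {suc n} p q r s h = begin
  𝟙 (p zero) + count (p ∘ suc) + (𝟙 (q zero) + count (q ∘ suc))
    ≡⟨ interchange (𝟙 (p zero)) _ _ _ ⟩
  𝟙 (p zero) + 𝟙 (q zero) + (count (p ∘ suc) + count (q ∘ suc))
    ≤⟨ +-mono-≤ (h zero) (count-lift-≤ (p ∘ suc) (q ∘ suc) (r ∘ suc) (s ∘ suc) (h ∘ suc)) ⟩
  𝟙 (r zero) + 𝟙 (s zero) + (count (r ∘ suc) + count (s ∘ suc))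
    ≡⟨ interchange (𝟙 (r zero)) _ _ _ ⟩
  𝟙 (r zero) + count (r ∘ suc) + (𝟙 (s zero) + count (s ∘ suc)) ∎
  where open ≤-Reasoning

count-lift-≡ : ∀ {n} (p q r s : Fin n → Bool) →
  (∀ z → 𝟙 (p z) + 𝟙 (q z) ≡ 𝟙 (r z) + 𝟙 (s z)) →
  count p + count q ≡ count r + count s
count-lift-≡ p q r s h = ≤-antisym
  (count-lift-≤ p q r s (λ z → ≤-reflexive (h z)))
  (count-lift-≤ r s p q (λ z → ≤-reflexive (sym (h z))))

count-false : ∀ {n} → count {n} (λ _ → false) ≡ 0
count-false {zero}  = refl
count-false {suc n} = count-false {n}

count-true : ∀ {n} → count {n} (λ _ → true) ≡ n
count-true {zero}  = refl
count-true {suc n} = cong suc (count-true {n})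

+-count-false : ∀ {n} m → m + count {n} (λ _ → false) ≡ m
+-count-false {n} m = trans (cong (m +_) (count-false {n})) (+-identityʳ m)

count-lift-≤₁ : ∀ {n} (p r s : Fin n → Bool) →
  (∀ z → 𝟙 (p z) ≤ 𝟙 (r z) + 𝟙 (s z)) → count p ≤ count r + count s
count-lift-≤₁ {n} p r s h = subst (_≤ count r + count s) (+-count-false {n} (count p))
  (count-lift-≤ p (λ _ → false) r s (λ z → ≤-trans (≤-reflexive (+-identityʳ (𝟙 (p z)))) (h z)))

count-mono : ∀ {n} {p q : Fin n → Bool} → (∀ z → p z ≡ true → q z ≡ true) → count p ≤ count q
count-mono {n} {p} {q} p⇒q =
  subst (count p ≤_) (+-count-false {n} (count q)) (count-lift-≤₁ p q (λ _ → false) pointwise)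
  where
  pointwise : ∀ z → 𝟙 (p z) ≤ 𝟙 (q z) + 0
  pointwise z with p z | p⇒q z
  ... | false | _   = z≤n
  ... | true  | p⇒q rewrite p⇒q refl = ≤-refl

count-∨ : ∀ {n} (p q : Fin n → Bool) → count (λ z → p z ∨ q z) ≤ count p + count q
count-∨ p q = count-lift-≤₁ _ p q (λ z → 𝟙-∨ (p z) (q z))
  where
  𝟙-∨ : ∀ a b → 𝟙 (a ∨ b) ≤ 𝟙 a + 𝟙 b
  𝟙-∨ true  b = s≤s z≤n
  𝟙-∨ false b = ≤-refl

count-∨-∧ : ∀ {n} (p q : Fin n → Bool) →
  count p + count q ≡ count (λ z → p z ∨ q z) + count (λ z → p z ∧ q z)
count-∨-∧ p q = count-lift-≡ p q _ _ (λ z → 𝟙-∨-∧ (p z) (q z))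
  where
  𝟙-∨-∧ : ∀ a b → 𝟙 a + 𝟙 b ≡ 𝟙 (a ∨ b) + 𝟙 (a ∧ b)
  𝟙-∨-∧ true  true  = refl
  𝟙-∨-∧ true  false = refl
  𝟙-∨-∧ false b     = sym (+-identityʳ (𝟙 b))

count-xor : ∀ {n} (p q : Fin n → Bool) →
  count (λ z → p z xor q z) + count (λ z → p z ∧ q z) + count (λ z → p z ∧ q z) ≡ count p + count q
count-xor {n} p q = begin
  count (λ z → p z xor q z) + count (λ z → p z ∧ q z) + count (λ z → p z ∧ q z)
    ≡⟨ cong (_+ count (λ z → p z ∧ q z)) (count-lift-≡ _ _ _ _ (λ z → 𝟙-xor (p z) (q z))) ⟩
  count (λ z → p z ∨ q z) + count {n} (λ _ → false) + count (λ z → p z ∧ q z)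
    ≡⟨ cong (_+ count (λ z → p z ∧ q z)) (+-count-false {n} _) ⟩
  count (λ z → p z ∨ q z) + count (λ z → p z ∧ q z)
    ≡⟨ count-∨-∧ p q ⟨
  count p + count q ∎
  where
  open ≡-Reasoning
  𝟙-xor : ∀ a b → 𝟙 (a xor b) + 𝟙 (a ∧ b) ≡ 𝟙 (a ∨ b) + 𝟙 false
  𝟙-xor true  true  = refl
  𝟙-xor true  false = refl
  𝟙-xor false true  = refl
  𝟙-xor false false = refl

count-not : ∀ {n} (p : Fin n → Bool) → count (λ z → not (p z)) + count p ≡ n
count-not {n} p = begin
  count (λ z → not (p z)) + count p  ≡⟨ count-lift-≡ _ p (λ _ → true) (λ _ → false) (λ z → 𝟙-not (p z)) ⟩
  count {n} (λ _ → true) + count {n} (λ _ → false) ≡⟨ cong₂ _+_ (count-true {n}) (count-false {n}) ⟩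
  n + 0                              ≡⟨ +-identityʳ n ⟩
  n                                  ∎
  where
  open ≡-Reasoning
  𝟙-not : ∀ a → 𝟙 (not a) + 𝟙 a ≡ 1
  𝟙-not true  = refl
  𝟙-not false = refl

count-∧-not : ∀ {n} (p q : Fin n → Bool) →
  count (λ z → p z ∧ q z) + count (λ z → p z ∧ not (q z)) ≡ count p
count-∧-not {n} p q =
  trans (count-lift-≡ _ _ p (λ _ → false) (λ z → 𝟙-∧-not (p z) (q z))) (+-count-false {n} (count p))
  where
  𝟙-∧-not : ∀ a b → 𝟙 (a ∧ b) + 𝟙 (a ∧ not b) ≡ 𝟙 a + 0
  𝟙-∧-not true  true  = refl
  𝟙-∧-not true  false = refl
  𝟙-∧-not false b     = refl

⌊suc≟suc⌋ : ∀ {n} (x z : Fin n) → ⌊ _≟_ {suc n} (suc x) (suc z) ⌋ ≡ ⌊ x ≟ z ⌋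
⌊suc≟suc⌋ x z with x ≟ z
... | yes _ = refl
... | no  _ = refl

count-singleton : ∀ {n} (x : Fin n) (q : Fin n → Bool) → count (λ z → ⌊ x ≟ z ⌋ ∧ q z) ≡ 𝟙 (q x)
count-singleton {suc n} zero    q = +-count-false {n} (𝟙 (q zero))
count-singleton {suc n} (suc x) q =
  trans (count-cong (λ z → cong (_∧ q (suc z)) (⌊suc≟suc⌋ x z))) (count-singleton x (q ∘ suc))

𝟙≤count : ∀ {n} (p : Fin n → Bool) (x : Fin n) → 𝟙 (p x) ≤ count p
𝟙≤count p x = subst (_≤ count p) (count-singleton x p) (count-mono only-p)
  where
  only-p : ∀ z → (⌊ x ≟ z ⌋ ∧ p z) ≡ true → p z ≡ true
  only-p z h with ⌊ x ≟ z ⌋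
  ... | true = h

𝟙+𝟙≤count : ∀ {n} (p : Fin n → Bool) {x y : Fin n} → x ≢ y → 𝟙 (p x) + 𝟙 (p y) ≤ count p
𝟙+𝟙≤count {n} p {x} {y} x≢y = begin
  𝟙 (p x) + 𝟙 (p y)
    ≡⟨ cong₂ _+_ (count-singleton x p) (count-singleton y p) ⟨
  count (λ z → ⌊ x ≟ z ⌋ ∧ p z) + count (λ z → ⌊ y ≟ z ⌋ ∧ p z)
    ≤⟨ count-lift-≤ _ _ p (λ _ → false) disjoint ⟩
  count p + count {n} (λ _ → false)
    ≡⟨ +-count-false {n} (count p) ⟩
  count p ∎
  where
  open ≤-Reasoning
  disjoint : ∀ z → 𝟙 (⌊ x ≟ z ⌋ ∧ p z) + 𝟙 (⌊ y ≟ z ⌋ ∧ p z) ≤ 𝟙 (p z) + 0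
  disjoint z with x ≟ z | y ≟ z
  ... | yes refl | yes refl = ⊥-elim (x≢y refl)
  ... | yes _    | no _     = ≤-refl
  ... | no _     | yes _    = m≤m+n _ 0
  ... | no _     | no _     = z≤n

count-pos⇒∃ : ∀ {n} (p : Fin n → Bool) → 1 ≤ count p → ∃ λ z → p z ≡ true
count-pos⇒∃ {suc n} p h with p zero in p₀
... | true  = zero , p₀
... | false with count-pos⇒∃ (p ∘ suc) h
...   | z , pz = suc z , pz

count-↑ : ∀ n {i} (p : Fin (n + i) → Bool) →
  count p ≡ count (λ x → p (x ↑ˡ i)) + count (λ j → p (n ↑ʳ j))
count-↑ zero    p = refl
count-↑ (suc n) p = trans (cong (𝟙 (p zero) +_) (count-↑ n (p ∘ suc))) (sym (+-assoc (𝟙 (p zero)) _ _))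

-- Identifying sets

there-meets : ∀ {N} {b} (C : Subset N) (S : Fin (suc N) → Bool) →
  suc N ≤ ∣ C ∣ + count (S ∘ suc) → ∃ λ z → z ∈ b Vec.∷ C × S z ≡ true

∣C∣+count>N⇒meets : ∀ {N} (C : Subset N) (S : Fin N → Bool) → suc N ≤ ∣ C ∣ + count S →
  ∃ λ z → z ∈ C × S z ≡ true
∣C∣+count>N⇒meets {suc N} (true Vec.∷ C) S h with S zero in S₀
... | true  = zero , here , S₀
... | false = there-meets C S (≤-pred h)
∣C∣+count>N⇒meets {suc N} (false Vec.∷ C) S h with S zero
... | true  = there-meets C S (≤-pred (subst (suc (suc N) ≤_) (+-suc ∣ C ∣ _) h))
... | false = there-meets C S (≤-trans (n≤1+n (suc N)) h)

there-meets C S h with ∣C∣+count>N⇒meets C (S ∘ suc) h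
... | z , z∈C , Sz = suc z , there z∈C , Sz

InGr-criterion : ∀ {N} (G : Graph N) (k : ℕ) → 1 ≤ k → k ≤ N →
  (∀ x → suc N ≤ count (inN G x) + k) →
  (∀ x y → x ≢ y → suc N ≤ count (λ z → inN G x z xor inN G y z) + k) →
  InGr N k G
InGr-criterion {N} G k 1≤k k≤N large-nbhd large-Δ = 1≤k , k≤N , identifying
  where
  meets : ∀ C S → ∣ C ∣ ≡ k → suc N ≤ count S + k → ∃ λ z → z ∈ C × S z ≡ true
  meets C S ∣C∣≡k h =
    ∣C∣+count>N⇒meets C S (subst (suc N ≤_) (trans (+-comm (count S) k) (cong (_+ count S) (sym ∣C∣≡k))) h)

  identifying : ∀ C → ∣ C ∣ ≡ k → IsIdentifying G C
  identifying C ∣C∣≡k = (λ x → meets C (inN G x) ∣C∣≡k (large-nbhd x)) , separates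
    where
    separates : ∀ x y → x ≢ y → ¬ (∀ z → z ∈ C → inN G x z ≡ inN G y z)
    separates x y x≢y agree with meets C _ ∣C∣≡k (large-Δ x y x≢y)
    ... | z , z∈C , differ rewrite agree z z∈C | xor-same (inN G y z) with differ
    ... | ()

-- Closed neighbourhoods

nonAdj : ∀ {n} → Graph n → Fin n → Fin n → Bool
nonAdj G x y = not (adj G x y)

adj⇒≢ : ∀ {n} (G : Graph n) {x y} → adj G x y ≡ true → x ≢ y
adj⇒≢ G {x} xy refl with trans (sym (Graph.irrefl G x)) xy
... | ()

⌊≟⌋-refl : ∀ {n} (x : Fin n) → ⌊ x ≟ x ⌋ ≡ true
⌊≟⌋-refl x with x ≟ x
... | yes _  = refl
... | no x≢x = ⊥-elim (x≢x refl)

⌊≟⌋-≢ : ∀ {n} {x y : Fin n} → x ≢ y → ⌊ x ≟ y ⌋ ≡ false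
⌊≟⌋-≢ {x = x} {y} x≢y with x ≟ y
... | yes x≡y = ⊥-elim (x≢y x≡y)
... | no _    = refl

⌊≟⌋-injective : ∀ {m n} (f : Fin m → Fin n) → (∀ {a b} → f a ≡ f b → a ≡ b) →
  ∀ a b → ⌊ f a ≟ f b ⌋ ≡ ⌊ a ≟ b ⌋
⌊≟⌋-injective f f-inj a b with a ≟ b
... | yes refl = ⌊≟⌋-refl (f a)
... | no a≢b   = ⌊≟⌋-≢ (a≢b ∘ f-inj)

module _ {n : ℕ} (G : Graph n) where

  inN-self : ∀ x → inN G x x ≡ true
  inN-self x = cong (_∨ adj G x x) (⌊≟⌋-refl x)

  inN-≢ : ∀ {x y} → x ≢ y → inN G x y ≡ adj G x y
  inN-≢ x≢y = cong (_∨ _) (⌊≟⌋-≢ x≢y)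

  count-inN : ∀ x → count (inN G x) ≡ suc (degree G x)
  count-inN x = begin
    count (inN G x)
      ≡⟨ +-count-false {n} (count (inN G x)) ⟨
    count (inN G x) + count {n} (λ _ → false)
      ≡⟨ count-lift-≡ _ _ _ _ split ⟩
    count (λ z → ⌊ x ≟ z ⌋ ∧ true) + count (adj G x)
      ≡⟨ cong (_+ count (adj G x)) (count-singleton x (λ _ → true)) ⟩
    suc (count (adj G x)) ∎
    where
    open ≡-Reasoning
    split : ∀ z → 𝟙 (inN G x z) + 𝟙 false ≡ 𝟙 (⌊ x ≟ z ⌋ ∧ true) + 𝟙 (adj G x z)
    split z with x ≟ z
    ... | yes refl rewrite Graph.irrefl G x = refl
    ... | no _     = +-identityʳ (𝟙 (adj G x z))

  count-inN∧ : ∀ x (q : Fin n → Bool) →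
    count (λ z → inN G x z ∧ q z) ≤ 𝟙 (q x) + count (λ z → adj G x z ∧ q z)
  count-inN∧ x q = begin
    count (λ z → inN G x z ∧ q z)
      ≡⟨ count-cong (λ z → ∧-distribʳ-∨ (q z) ⌊ x ≟ z ⌋ (adj G x z)) ⟩
    count (λ z → (⌊ x ≟ z ⌋ ∧ q z) ∨ (adj G x z ∧ q z))
      ≤⟨ count-∨ (λ z → ⌊ x ≟ z ⌋ ∧ q z) (λ z → adj G x z ∧ q z) ⟩
    count (λ z → ⌊ x ≟ z ⌋ ∧ q z) + count (λ z → adj G x z ∧ q z)
      ≡⟨ cong (_+ count (λ z → adj G x z ∧ q z)) (count-singleton x q) ⟩
    𝟙 (q x) + count (λ z → adj G x z ∧ q z) ∎
    where open ≤-Reasoning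

  count-inN∧inN : ∀ {x y} → x ≢ y →
    count (λ z → inN G x z ∧ inN G y z) ≤ 𝟙 (adj G x y) + 𝟙 (adj G x y) + commonNeighbours G x y
  count-inN∧inN {x} {y} x≢y = begin
    count (λ z → inN G x z ∧ inN G y z)
      ≤⟨ count-inN∧ x (inN G y) ⟩
    𝟙 (inN G y x) + count (λ z → adj G x z ∧ inN G y z)
      ≡⟨ cong₂ _+_ (cong 𝟙 (trans (inN-≢ (x≢y ∘ sym)) (Graph.sym G y x)))
                   (count-cong (λ z → ∧-comm (adj G x z) (inN G y z))) ⟩
    𝟙 (adj G x y) + count (λ z → inN G y z ∧ adj G x z)
      ≤⟨ +-monoʳ-≤ (𝟙 (adj G x y)) (count-inN∧ y (adj G x)) ⟩
    𝟙 (adj G x y) + (𝟙 (adj G x y) + count (λ z → adj G y z ∧ adj G x z))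
      ≡⟨ sym (+-assoc (𝟙 (adj G x y)) _ _) ⟩
    𝟙 (adj G x y) + 𝟙 (adj G x y) + count (λ z → adj G y z ∧ adj G x z)
      ≡⟨ cong (_ +_) (count-cong (λ z → ∧-comm (adj G y z) (adj G x z))) ⟩
    𝟙 (adj G x y) + 𝟙 (adj G x y) + commonNeighbours G x y ∎
    where open ≤-Reasoning

-- Arithmetic

Δ-bound : ∀ {m X B c S b K} → X + B + B ≡ S → B ≤ c → m + (c + c) ≤ S + b + K → m ≤ X + b + K
Δ-bound {m} {X} {B} {c} {S} {b} {K} X+2B≡S B≤c m+2c≤S+b+K = +-cancelʳ-≤ (c + c) m (X + b + K) (begin
  m + (c + c)          ≤⟨ m+2c≤S+b+K ⟩
  S + b + K            ≡⟨ cong (λ s → s + b + K) X+2B≡S ⟨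
  X + B + B + b + K    ≡⟨ solve (X ∷ B ∷ b ∷ K ∷ []) ⟩
  X + b + K + (B + B)  ≤⟨ +-monoʳ-≤ (X + b + K) (+-mono-≤ B≤c B≤c) ⟩
  X + b + K + (c + c)  ∎)
  where open ≤-Reasoning

m∸n≤o⇒m≤n+o : ∀ m n {o} → m ∸ n ≤ o → m ≤ n + o
m∸n≤o⇒m≤n+o m n m∸n≤o = ≤-trans (m≤n+m∸n m n) (+-monoʳ-≤ n m∸n≤o)

module Conditions (n t λ' μ K : ℕ) (k₀≤K : k₀ n t λ' μ ≤ K) (K≤n : K ≤ n) where

  private
    A B C D E F : ℕ
    A = n ∸ t
    B = t
    C = n + 2 * λ' + 3 ∸ 2 * t
    D = n + 2 * μ ∸ (2 * t + 1)
    E = 2 * t ∸ (2 * λ' + 1)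
    F = 2 * t + 2 ∸ 2 * μ

    A⊔B⊔C⊔D⊔E≤K : A ⊔ B ⊔ C ⊔ D ⊔ E ≤ K
    A⊔B⊔C⊔D⊔E≤K = m⊔n≤o⇒m≤o _ F k₀≤K
    A⊔B⊔C⊔D≤K : A ⊔ B ⊔ C ⊔ D ≤ K
    A⊔B⊔C⊔D≤K = m⊔n≤o⇒m≤o _ E A⊔B⊔C⊔D⊔E≤K
    A⊔B⊔C≤K : A ⊔ B ⊔ C ≤ K
    A⊔B⊔C≤K = m⊔n≤o⇒m≤o _ D A⊔B⊔C⊔D≤K
    A⊔B≤K : A ⊔ B ≤ K
    A⊔B≤K = m⊔n≤o⇒m≤o _ C A⊔B⊔C≤K

  n≤t+K : n ≤ t + K
  n≤t+K = m∸n≤o⇒m≤n+o n t (m⊔n≤o⇒m≤o A B A⊔B≤K)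

  t≤K : t ≤ K
  t≤K = m⊔n≤o⇒n≤o A B A⊔B≤K

  n+2λ+3≤2t+K : n + 2 * λ' + 3 ≤ 2 * t + K
  n+2λ+3≤2t+K = m∸n≤o⇒m≤n+o _ _ (m⊔n≤o⇒n≤o (A ⊔ B) C A⊔B⊔C≤K)

  n+2μ≤2t+1+K : n + 2 * μ ≤ 2 * t + 1 + K
  n+2μ≤2t+1+K = m∸n≤o⇒m≤n+o _ _ (m⊔n≤o⇒n≤o (A ⊔ B ⊔ C) D A⊔B⊔C⊔D≤K)

  2t≤2λ+1+K : 2 * t ≤ 2 * λ' + 1 + K
  2t≤2λ+1+K = m∸n≤o⇒m≤n+o _ _ (m⊔n≤o⇒n≤o (A ⊔ B ⊔ C ⊔ D) E A⊔B⊔C⊔D⊔E≤K)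

  2t+2≤2μ+K : 2 * t + 2 ≤ 2 * μ + K
  2t+2≤2μ+K = m∸n≤o⇒m≤n+o _ _ (m⊔n≤o⇒n≤o (A ⊔ B ⊔ C ⊔ D ⊔ E) F k₀≤K)

  2≤t : 2 ≤ t
  2≤t = *-cancelˡ-< 2 1 t (+-cancelʳ-≤ n 3 (2 * t) (begin
    3 + n                ≤⟨ +-monoʳ-≤ 3 (m≤m+n n (2 * λ')) ⟩
    3 + (n + 2 * λ')     ≡⟨ +-comm 3 _ ⟩
    n + 2 * λ' + 3       ≤⟨ n+2λ+3≤2t+K ⟩
    2 * t + K            ≤⟨ +-monoʳ-≤ (2 * t) K≤n ⟩
    2 * t + n            ∎))
    where open ≤-Reasoning

  2≤K : 2 ≤ K
  2≤K = ≤-trans 2≤t t≤K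

  old-nbhd-ineq : suc n ≤ suc t + 0 + K
  old-nbhd-ineq = s≤s (subst (λ s → n ≤ s + K) (sym (+-identityʳ t)) n≤t+K)

  copy-nbhd-ineq : ∀ {q} → q + t ≡ n → suc n ≤ q + 1 + K
  copy-nbhd-ineq {q} q+t≡n = begin
    suc n        ≡⟨ cong suc q+t≡n ⟨
    suc (q + t)  ≤⟨ s≤s (+-monoʳ-≤ q t≤K) ⟩
    suc (q + K)  ≡⟨ solve (q ∷ K ∷ []) ⟩
    q + 1 + K    ∎
    where open ≤-Reasoning

  apex-nbhd-ineq : suc n ≤ 0 + n + K
  apex-nbhd-ineq = subst (_≤ n + K) (+-comm n 1) (+-monoʳ-≤ n (≤-trans (s≤s z≤n) 2≤K))

  old-old-adj-ineq : suc n + (2 + λ' + (2 + λ')) ≤ suc t + suc t + 0 + K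
  old-old-adj-ineq = begin
    suc n + (2 + λ' + (2 + λ'))  ≡⟨ solve (n ∷ λ' ∷ []) ⟩
    n + 2 * λ' + 3 + 2           ≤⟨ +-monoˡ-≤ 2 n+2λ+3≤2t+K ⟩
    2 * t + K + 2                ≡⟨ solve (t ∷ K ∷ []) ⟩
    suc t + suc t + 0 + K        ∎
    where open ≤-Reasoning

  old-old-nonadj-ineq : suc n + (μ + μ) ≤ suc t + suc t + 0 + K
  old-old-nonadj-ineq = begin
    suc n + (μ + μ)        ≡⟨ solve (n ∷ μ ∷ []) ⟩
    n + 2 * μ + 1          ≤⟨ +-monoˡ-≤ 1 n+2μ≤2t+1+K ⟩
    2 * t + 1 + K + 1      ≡⟨ solve (t ∷ K ∷ []) ⟩
    suc t + suc t + 0 + K  ∎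
    where open ≤-Reasoning

  old-copy-self-ineq : suc n + (1 + 1) ≤ suc n + 0 + K
  old-copy-self-ineq = subst (suc n + 2 ≤_) (cong (_+ K) (sym (+-identityʳ (suc n)))) (+-monoʳ-≤ (suc n) 2≤K)

  old-copy-adj-ineq : ∀ {d} → d + λ' ≡ t → suc n + (d + d) ≤ suc n + 1 + K
  old-copy-adj-ineq {d} d+λ≡t = subst (suc n + (d + d) ≤_) (sym (+-assoc (suc n) 1 K))
    (+-monoʳ-≤ (suc n) (+-cancelʳ-≤ (λ' + λ') (d + d) (1 + K) (begin
      d + d + (λ' + λ')  ≡⟨ solve (d ∷ λ' ∷ []) ⟩
      2 * (d + λ')       ≡⟨ cong (2 *_) d+λ≡t ⟩
      2 * t              ≤⟨ 2t≤2λ+1+K ⟩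
      2 * λ' + 1 + K     ≡⟨ solve (λ' ∷ K ∷ []) ⟩
      1 + K + (λ' + λ')  ∎)))
    where open ≤-Reasoning

  old-copy-nonadj-ineq : ∀ {d} → d + μ ≡ t → suc n + (suc d + suc d) ≤ suc n + 0 + K
  old-copy-nonadj-ineq {d} d+μ≡t = subst (suc n + (suc d + suc d) ≤_) (cong (_+ K) (sym (+-identityʳ (suc n))))
    (+-monoʳ-≤ (suc n) (+-cancelʳ-≤ (μ + μ) (suc d + suc d) K (begin
      suc d + suc d + (μ + μ)  ≡⟨ solve (d ∷ μ ∷ []) ⟩
      2 * (d + μ) + 2          ≡⟨ cong (λ s → 2 * s + 2) d+μ≡t ⟩
      2 * t + 2                ≤⟨ 2t+2≤2μ+K ⟩
      2 * μ + K                ≡⟨ solve (μ ∷ K ∷ []) ⟩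
      K + (μ + μ)              ∎)))
    where open ≤-Reasoning

  copy-copy-adj-ineq : suc n + (λ' + λ') ≤ t + t + 0 + K
  copy-copy-adj-ineq = begin
    suc n + (λ' + λ')   ≤⟨ +-monoˡ-≤ (λ' + λ') (m≤n+m (suc n) 2) ⟩
    3 + n + (λ' + λ')   ≡⟨ solve (n ∷ λ' ∷ []) ⟩
    n + 2 * λ' + 3      ≤⟨ n+2λ+3≤2t+K ⟩
    2 * t + K           ≡⟨ solve (t ∷ K ∷ []) ⟩
    t + t + 0 + K       ∎
    where open ≤-Reasoning

  copy-copy-nonadj-ineq : suc n + (μ + μ) ≤ t + t + 2 + K
  copy-copy-nonadj-ineq = begin
    suc n + (μ + μ)      ≡⟨ solve (n ∷ μ ∷ []) ⟩
    n + 2 * μ + 1        ≤⟨ +-monoˡ-≤ 1 n+2μ≤2t+1+K ⟩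
    2 * t + 1 + K + 1    ≡⟨ solve (t ∷ K ∷ []) ⟩
    t + t + 2 + K        ∎
    where open ≤-Reasoning

  copy-apex-ineq : ∀ {q r} → q + t ≡ n → r + suc t ≡ n → t + t ≤ λ' + n → suc n ≤ q + r + K
  copy-apex-ineq {q} {r} q+t≡n r+1+t≡n 2t≤λ+n = +-cancelʳ-≤ (t + suc t) (suc n) (q + r + K) (begin
    suc n + (t + suc t)          ≡⟨ solve (n ∷ t ∷ []) ⟩
    t + t + (n + 2)              ≤⟨ +-monoˡ-≤ (n + 2) 2t≤λ+n ⟩
    λ' + n + (n + 2)             ≡⟨ solve (λ' ∷ n ∷ []) ⟩
    λ' + 2 + (n + n)             ≤⟨ +-monoˡ-≤ (n + n) λ+2≤K ⟩
    K + (n + n)                  ≡⟨ cong₂ (λ a b → K + (a + b)) q+t≡n r+1+t≡n ⟨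
    K + (q + t + (r + suc t))    ≡⟨ solve (q ∷ r ∷ t ∷ K ∷ []) ⟩
    q + r + K + (t + suc t)      ∎)
    where
    open ≤-Reasoning
    λ+2≤K : λ' + 2 ≤ K
    λ+2≤K = ≤-trans (+-monoʳ-≤ λ' (n≤1+n 2)) (+-cancelʳ-≤ (n + λ') (λ' + 3) K (begin
      λ' + 3 + (n + λ')  ≡⟨ solve (λ' ∷ n ∷ []) ⟩
      n + 2 * λ' + 3     ≤⟨ n+2λ+3≤2t+K ⟩
      2 * t + K          ≤⟨ +-monoˡ-≤ K (subst (_≤ λ' + n) (cong (t +_) (sym (+-identityʳ t))) 2t≤λ+n) ⟩
      λ' + n + K         ≡⟨ solve (λ' ∷ n ∷ K ∷ []) ⟩
      K + (n + λ')       ∎))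

-- Strongly regular graphs

module StronglyRegular {n : ℕ} (G : Graph n) {t λ' μ : ℕ} (srg : IsStronglyRegular G t λ' μ) where

  private
    regular : ∀ x → count (adj G x) ≡ t
    regular = proj₁ srg
    λ-common : ∀ x y → x ≢ y → adj G x y ≡ true → commonNeighbours G x y ≡ λ'
    λ-common = proj₁ (proj₂ srg)
    μ-common : ∀ x y → x ≢ y → adj G x y ≡ false → commonNeighbours G x y ≡ μ
    μ-common = proj₂ (proj₂ srg)

  count-inN≡1+t : ∀ x → count (inN G x) ≡ suc t
  count-inN≡1+t x = trans (count-inN G x) (cong suc (regular x))

  count-nonAdj : ∀ x → count (nonAdj G x) + t ≡ n
  count-nonAdj x = trans (cong (count (nonAdj G x) +_) (sym (regular x))) (count-not (adj G x))

  count-¬inN : ∀ x → count (λ z → not (inN G x z)) + suc t ≡ n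
  count-¬inN x = trans (cong (count (λ z → not (inN G x z)) +_) (sym (count-inN≡1+t x))) (count-not (inN G x))

  count-adj∧nonAdj+common : ∀ x y → count (λ z → adj G x z ∧ nonAdj G y z) + commonNeighbours G x y ≡ t
  count-adj∧nonAdj+common x y = trans (+-comm _ (commonNeighbours G x y)) (trans (count-∧-not (adj G x) (adj G y)) (regular x))

  count-adj∧nonAdj+λ : ∀ {x y} → x ≢ y → adj G x y ≡ true → count (λ z → adj G x z ∧ nonAdj G y z) + λ' ≡ t
  count-adj∧nonAdj+λ {x} {y} x≢y xy =
    subst (λ c → count (λ z → adj G x z ∧ nonAdj G y z) + c ≡ t) (λ-common x y x≢y xy) (count-adj∧nonAdj+common x y)

  count-adj∧nonAdj+μ : ∀ {x y} → x ≢ y → adj G x y ≡ false → count (λ z → adj G x z ∧ nonAdj G y z) + μ ≡ t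
  count-adj∧nonAdj+μ {x} {y} x≢y xy =
    subst (λ c → count (λ z → adj G x z ∧ nonAdj G y z) + c ≡ t) (μ-common x y x≢y xy) (count-adj∧nonAdj+common x y)

  count-inN∧inN≤2+λ : ∀ {x y} → x ≢ y → adj G x y ≡ true → count (λ z → inN G x z ∧ inN G y z) ≤ 2 + λ'
  count-inN∧inN≤2+λ {x} {y} x≢y xy = begin
    count (λ z → inN G x z ∧ inN G y z)                  ≤⟨ count-inN∧inN G x≢y ⟩
    𝟙 (adj G x y) + 𝟙 (adj G x y) + commonNeighbours G x y
      ≡⟨ cong₂ (λ a c → 𝟙 a + 𝟙 a + c) xy (λ-common x y x≢y xy) ⟩
    2 + λ'                                               ∎
    where open ≤-Reasoning

  count-inN∧inN≤μ : ∀ {x y} → x ≢ y → adj G x y ≡ false → count (λ z → inN G x z ∧ inN G y z) ≤ μ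
  count-inN∧inN≤μ {x} {y} x≢y xy = begin
    count (λ z → inN G x z ∧ inN G y z)                  ≤⟨ count-inN∧inN G x≢y ⟩
    𝟙 (adj G x y) + 𝟙 (adj G x y) + commonNeighbours G x y
      ≡⟨ cong₂ (λ a c → 𝟙 a + 𝟙 a + c) xy (μ-common x y x≢y xy) ⟩
    μ                                                    ∎
    where open ≤-Reasoning

  -- counting N(x) ∖ N(y) for an edge xy: t − λ ≤ n − t
  2t≤λ+n : 1 ≤ t → Fin n → t + t ≤ λ' + n
  2t≤λ+n 1≤t x with count-pos⇒∃ (adj G x) (subst (1 ≤_) (sym (regular x)) 1≤t)
  ... | y , xy = begin
    t + t                                                      ≡⟨ cong (_+ t) (count-adj∧nonAdj+λ x≢y xy) ⟨
    count (λ z → adj G x z ∧ nonAdj G y z) + λ' + t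
      ≤⟨ +-monoˡ-≤ t (+-monoˡ-≤ λ' (count-mono only-nonAdj)) ⟩
    count (nonAdj G y) + λ' + t                                ≡⟨ cong (_+ t) (+-comm _ λ') ⟩
    λ' + count (nonAdj G y) + t                                ≡⟨ +-assoc λ' _ t ⟩
    λ' + (count (nonAdj G y) + t)                              ≡⟨ cong (λ' +_) (count-nonAdj y) ⟩
    λ' + n                                                     ∎
    where
    open ≤-Reasoning
    x≢y : x ≢ y
    x≢y = adj⇒≢ G xy
    only-nonAdj : ∀ z → (adj G x z ∧ nonAdj G y z) ≡ true → nonAdj G y z ≡ true
    only-nonAdj z h with adj G x z
    ... | true = h

  count-inN∧nonAdj : ∀ {x y b} → adj G x y ≡ b →
    count (λ z → inN G x z ∧ nonAdj G y z) ≤ 𝟙 (not b) + count (λ z → adj G x z ∧ nonAdj G y z)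
  count-inN∧nonAdj {x} {y} xy = subst (λ a → count (λ z → inN G x z ∧ nonAdj G y z) ≤ 𝟙 (not a) + _)
    (trans (Graph.sym G y x) xy) (count-inN∧ G x (nonAdj G y))

  count-inN∆inN : ∀ x y →
    count (λ z → inN G x z xor inN G y z) + count (λ z → inN G x z ∧ inN G y z) + count (λ z → inN G x z ∧ inN G y z)
      ≡ suc t + suc t
  count-inN∆inN x y = trans (count-xor (inN G x) (inN G y)) (cong₂ _+_ (count-inN≡1+t x) (count-inN≡1+t y))

  count-inN∆nonAdj : ∀ x y →
    count (λ z → inN G x z xor nonAdj G y z) + count (λ z → inN G x z ∧ nonAdj G y z) + count (λ z → inN G x z ∧ nonAdj G y z)
      ≡ suc n
  count-inN∆nonAdj x y = begin
    _                                       ≡⟨ count-xor (inN G x) (nonAdj G y) ⟩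
    count (inN G x) + count (nonAdj G y)    ≡⟨ cong (_+ count (nonAdj G y)) (count-inN≡1+t x) ⟩
    suc t + count (nonAdj G y)              ≡⟨ cong suc (+-comm t _) ⟩
    suc (count (nonAdj G y) + t)            ≡⟨ cong suc (count-nonAdj y) ⟩
    suc n                                   ∎
    where open ≡-Reasoning

  count-nonAdj∆nonAdj : ∀ x y →
    count (λ z → nonAdj G x z xor nonAdj G y z) + commonNeighbours G x y + commonNeighbours G x y ≡ t + t
  count-nonAdj∆nonAdj x y = begin
    count (λ z → nonAdj G x z xor nonAdj G y z) + commonNeighbours G x y + commonNeighbours G x y
      ≡⟨ cong (λ c → c + commonNeighbours G x y + commonNeighbours G x y)
              (count-cong (λ z → not-xor-not (adj G x z) (adj G y z))) ⟩
    count (λ z → adj G x z xor adj G y z) + commonNeighbours G x y + commonNeighbours G x y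
      ≡⟨ count-xor (adj G x) (adj G y) ⟩
    count (adj G x) + count (adj G y)
      ≡⟨ cong₂ _+_ (regular x) (regular y) ⟩
    t + t ∎
    where
    open ≡-Reasoning
    not-xor-not : ∀ a b → (not a xor not b) ≡ (a xor b)
    not-xor-not true  b = refl
    not-xor-not false b = not-involutive b

  module Separation {K : ℕ} (k₀≤K : k₀ n t λ' μ ≤ K) (K≤n : K ≤ n) where

    open Conditions n t λ' μ K k₀≤K K≤n public

    inN-large : ∀ x → suc n ≤ count (inN G x) + 0 + K
    inN-large x = subst (λ c → suc n ≤ c + 0 + K) (sym (count-inN≡1+t x)) old-nbhd-ineq

    nonAdj-large : ∀ x → suc n ≤ count (nonAdj G x) + 1 + K
    nonAdj-large x = copy-nbhd-ineq (count-nonAdj x)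

    inN∆inN-large : ∀ {x y} → x ≢ y → suc n ≤ count (λ z → inN G x z xor inN G y z) + 0 + K
    inN∆inN-large {x} {y} x≢y with adj G x y in xy
    ... | true  = Δ-bound (count-inN∆inN x y) (count-inN∧inN≤2+λ x≢y xy) old-old-adj-ineq
    ... | false = Δ-bound (count-inN∆inN x y) (count-inN∧inN≤μ x≢y xy) old-old-nonadj-ineq

    inN∆nonAdj-large : ∀ x y → suc n ≤ count (λ z → inN G x z xor nonAdj G y z) + 𝟙 (adj G x y) + K
    inN∆nonAdj-large x y with x ≟ y
    ... | yes refl rewrite Graph.irrefl G x = Δ-bound (count-inN∆nonAdj x x) B≤1 old-copy-self-ineq
      where
      B≤1 : count (λ z → inN G x z ∧ nonAdj G x z) ≤ 1 + 0
      B≤1 = ≤-trans (count-inN∧nonAdj (Graph.irrefl G x))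
                    (≤-reflexive (cong (1 +_) (trans (count-cong (∧-inverseʳ ∘ adj G x)) (count-false {n}))))
    ... | no x≢y with adj G x y in xy
    ...   | true  = Δ-bound (count-inN∆nonAdj x y) (count-inN∧nonAdj xy) (old-copy-adj-ineq (count-adj∧nonAdj+λ x≢y xy))
    ...   | false = Δ-bound (count-inN∆nonAdj x y) (count-inN∧nonAdj xy) (old-copy-nonadj-ineq (count-adj∧nonAdj+μ x≢y xy))

    nonAdj∆nonAdj-large : ∀ {x y} → x ≢ y →
      suc n ≤ count (λ z → nonAdj G x z xor nonAdj G y z) + (𝟙 (nonAdj G x y) + 𝟙 (nonAdj G x y)) + K
    nonAdj∆nonAdj-large {x} {y} x≢y with adj G x y in xy
    ... | true  = Δ-bound (count-nonAdj∆nonAdj x y) (≤-reflexive (λ-common x y x≢y xy)) copy-copy-adj-ineq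
    ... | false = Δ-bound (count-nonAdj∆nonAdj x y) (≤-reflexive (μ-common x y x≢y xy)) copy-copy-nonadj-ineq

    nonAdj+¬inN-large : ∀ x → suc n ≤ count (nonAdj G x) + count (λ z → not (inN G x z)) + K
    nonAdj+¬inN-large x = copy-apex-ineq (count-nonAdj x) (count-¬inN x) (2t≤λ+n (≤-trans (s≤s z≤n) 2≤t) x)

-- The extension

data Added (n : ℕ) : Set where
  copy : Fin n → Added n
  apex : Added n

copy-injective : ∀ {n} {x y : Fin n} → copy x ≡ copy y → x ≡ y
copy-injective refl = refl

module Extension {n i : ℕ} (G : Graph n) (label : Fin i → Added n) where

  Vertex : Set
  Vertex = Fin n ⊎ Added n

  adjᵛ : Vertex → Vertex → Bool
  adjᵛ (inj₁ x)        (inj₁ y)        = adj G x y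
  adjᵛ (inj₁ x)        (inj₂ (copy y)) = nonAdj G y x
  adjᵛ (inj₁ _)        (inj₂ apex)     = false
  adjᵛ (inj₂ (copy x)) (inj₁ y)        = nonAdj G x y
  adjᵛ (inj₂ (copy x)) (inj₂ (copy y)) = adj G x y
  adjᵛ (inj₂ (copy _)) (inj₂ apex)     = true
  adjᵛ (inj₂ apex)     (inj₁ _)        = false
  adjᵛ (inj₂ apex)     (inj₂ (copy _)) = true
  adjᵛ (inj₂ apex)     (inj₂ apex)     = false

  adjᵛ-sym : ∀ u v → adjᵛ u v ≡ adjᵛ v u
  adjᵛ-sym (inj₁ x)        (inj₁ y)        = Graph.sym G x y
  adjᵛ-sym (inj₁ x)        (inj₂ (copy y)) = refl
  adjᵛ-sym (inj₁ _)        (inj₂ apex)     = refl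
  adjᵛ-sym (inj₂ (copy x)) (inj₁ y)        = refl
  adjᵛ-sym (inj₂ (copy x)) (inj₂ (copy y)) = Graph.sym G x y
  adjᵛ-sym (inj₂ (copy _)) (inj₂ apex)     = refl
  adjᵛ-sym (inj₂ apex)     (inj₁ _)        = refl
  adjᵛ-sym (inj₂ apex)     (inj₂ (copy _)) = refl
  adjᵛ-sym (inj₂ apex)     (inj₂ apex)     = refl

  adjᵛ-irrefl : ∀ u → adjᵛ u u ≡ false
  adjᵛ-irrefl (inj₁ x)        = Graph.irrefl G x
  adjᵛ-irrefl (inj₂ (copy x)) = Graph.irrefl G x
  adjᵛ-irrefl (inj₂ apex)     = refl

  vertex : Fin (n + i) → Vertex
  vertex = map₂ label ∘ splitAt n

  H : Graph (n + i)
  H = record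
    { adj    = λ u v → adjᵛ (vertex u) (vertex v)
    ; sym    = λ u v → adjᵛ-sym (vertex u) (vertex v)
    ; irrefl = λ u → adjᵛ-irrefl (vertex u)
    }

  vertex-old : ∀ x → vertex (x ↑ˡ i) ≡ inj₁ x
  vertex-old x = cong (map₂ label) (splitAt-↑ˡ n x i)

  vertex-new : ∀ j → vertex (n ↑ʳ j) ≡ inj₂ (label j)
  vertex-new j = cong (map₂ label) (splitAt-↑ʳ n i j)

  old≢new : ∀ x j → x ↑ˡ i ≢ n ↑ʳ j
  old≢new x j eq with trans (sym (splitAt-↑ˡ n x i)) (trans (cong (splitAt n) eq) (splitAt-↑ʳ n i j))
  ... | ()

  inN-old-old : ∀ x w → inN H (x ↑ˡ i) (w ↑ˡ i) ≡ inN G x w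
  inN-old-old x w rewrite vertex-old x | vertex-old w | ⌊≟⌋-injective (_↑ˡ i) (↑ˡ-injective i _ _) x w = refl

  inN-old-new : ∀ x j → inN H (x ↑ˡ i) (n ↑ʳ j) ≡ adjᵛ (inj₁ x) (inj₂ (label j))
  inN-old-new x j rewrite vertex-old x | vertex-new j | ⌊≟⌋-≢ (old≢new x j) = refl

  inN-new-old : ∀ j w → inN H (n ↑ʳ j) (w ↑ˡ i) ≡ adjᵛ (inj₂ (label j)) (inj₁ w)
  inN-new-old j w rewrite vertex-old w | vertex-new j | ⌊≟⌋-≢ (old≢new w j ∘ sym) = refl

  inN-new-new : ∀ j j' → inN H (n ↑ʳ j) (n ↑ʳ j') ≡ ⌊ j ≟ j' ⌋ ∨ adjᵛ (inj₂ (label j)) (inj₂ (label j'))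
  inN-new-new j j' rewrite vertex-new j | vertex-new j' | ⌊≟⌋-injective (n ↑ʳ_) (↑ʳ-injective n _ _) j j' = refl

  data View : Fin (n + i) → Set where
    old : (x : Fin n) → View (x ↑ˡ i)
    new : (j : Fin i) → View (n ↑ʳ j)

  view : ∀ u → View u
  view u with splitAt n u in eq
  ... | inj₁ x rewrite sym (splitAt⁻¹-↑ˡ eq) = old x
  ... | inj₂ j rewrite sym (splitAt⁻¹-↑ʳ eq) = new j

  module Identifying {t λ' μ K : ℕ} (srg : IsStronglyRegular G t λ' μ) (k₀≤K : k₀ n t λ' μ ≤ K) (K≤n : K ≤ n)
    (label-injective : ∀ {j j'} → label j ≡ label j' → j ≡ j')
    -- pos lists the copies; the counting inequality says that it is injective
    (apex⇒all-copies : ∀ {j} → label j ≡ apex →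
      Σ (Fin n → Fin i) λ pos → (∀ y → label (pos y) ≡ copy y) × (∀ p → count (p ∘ pos) ≤ count p))
    where

    open StronglyRegular G srg
    open Separation k₀≤K K≤n

    Large : (Fin (n + i) → Bool) → Set
    Large f = suc (n + i) ≤ count f + (K + i)

    large-in-H : ∀ (f : Fin (n + i) → Bool) {a b} → suc n ≤ a + b + K →
      a ≤ count (λ x → f (x ↑ˡ i)) → b ≤ count (λ j → f (n ↑ʳ j)) → Large f
    large-in-H f {a} {b} large a≤ b≤ = begin
      suc n + i                                                  ≤⟨ +-monoˡ-≤ i large ⟩
      a + b + K + i                                              ≤⟨ +-monoˡ-≤ i (+-monoˡ-≤ K (+-mono-≤ a≤ b≤)) ⟩
      count (λ x → f (x ↑ˡ i)) + count (λ j → f (n ↑ʳ j)) + K + i ≡⟨ cong (λ c → c + K + i) (count-↑ n f) ⟨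
      count f + K + i                                            ≡⟨ +-assoc (count f) K i ⟩
      count f + (K + i)                                          ∎
      where open ≤-Reasoning

    nbhd-large : ∀ u → Large (inN H u)
    nbhd-large u with view u
    ... | old x = large-in-H _ (inN-large x) (≤-reflexive (count-cong (sym ∘ inN-old-old x))) z≤n
    ... | new j with label j in ℓ
    ...   | copy x = large-in-H _ (nonAdj-large x) (≤-reflexive (count-cong old-part)) self
      where
      old-part : ∀ w → nonAdj G x w ≡ inN H (n ↑ʳ j) (w ↑ˡ i)
      old-part w rewrite inN-new-old j w | ℓ = refl
      self : 1 ≤ count (λ j' → inN H (n ↑ʳ j) (n ↑ʳ j'))
      self = subst (λ b → 𝟙 b ≤ count (λ j' → inN H (n ↑ʳ j) (n ↑ʳ j'))) (inN-self H (n ↑ʳ j)) (𝟙≤count _ j)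
    ...   | apex with apex⇒all-copies ℓ
    ...     | pos , pos-copy , pos-count = large-in-H _ apex-nbhd-ineq z≤n (begin
      n                                                    ≡⟨ count-true ⟨
      count {n} (λ _ → true)                                ≡⟨ count-cong sees-copy ⟩
      count (λ y → inN H (n ↑ʳ j) (n ↑ʳ pos y))            ≤⟨ pos-count _ ⟩
      count (λ j' → inN H (n ↑ʳ j) (n ↑ʳ j'))              ∎)
      where
      open ≤-Reasoning
      sees-copy : ∀ y → true ≡ inN H (n ↑ʳ j) (n ↑ʳ pos y)
      sees-copy y rewrite inN-new-new j (pos y) | ℓ | pos-copy y = sym (∨-zeroʳ _)

    Δ : Fin (n + i) → Fin (n + i) → Fin (n + i) → Bool
    Δ u v z = inN H u z xor inN H v z

    Δ-large-sym : ∀ u v → Large (Δ u v) → Large (Δ v u)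
    Δ-large-sym u v = subst (λ c → suc (n + i) ≤ c + (K + i)) (count-cong (λ z → xor-comm (inN H u z) (inN H v z)))

    ⌊≟⌋-copies : ∀ {j j' x y} → label j ≡ copy x → label j' ≡ copy y → ⌊ j ≟ j' ⌋ ≡ ⌊ x ≟ y ⌋
    ⌊≟⌋-copies {j} {j'} {x} {y} ℓ ℓ' with j ≟ j' | x ≟ y
    ... | yes refl | yes _   = refl
    ... | yes refl | no x≢y  = ⊥-elim (x≢y (copy-injective (trans (sym ℓ) ℓ')))
    ... | no j≢j'  | yes refl = ⊥-elim (j≢j' (label-injective (trans ℓ (sym ℓ'))))
    ... | no _     | no _     = refl

    old-old-large : ∀ {x y} → x ≢ y → Large (Δ (x ↑ˡ i) (y ↑ˡ i))
    old-old-large {x} {y} x≢y = large-in-H _ (inN∆inN-large x≢y) (≤-reflexive (count-cong old-part)) z≤n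
      where
      old-part : ∀ w → (inN G x w xor inN G y w) ≡ Δ (x ↑ˡ i) (y ↑ˡ i) (w ↑ˡ i)
      old-part w = sym (cong₂ _xor_ (inN-old-old x w) (inN-old-old y w))

    old-new-large : ∀ x j → Large (Δ (x ↑ˡ i) (n ↑ʳ j))
    old-new-large x j with label j in ℓ
    ... | copy y = large-in-H _ (inN∆nonAdj-large x y) (≤-reflexive (count-cong old-part))
                     (subst (λ b → 𝟙 b ≤ count (λ j' → Δ (x ↑ˡ i) (n ↑ʳ j) (n ↑ʳ j'))) at-copy (𝟙≤count _ j))
      where
      old-part : ∀ w → (inN G x w xor nonAdj G y w) ≡ Δ (x ↑ˡ i) (n ↑ʳ j) (w ↑ˡ i)
      old-part w rewrite inN-old-old x w | inN-new-old j w | ℓ = refl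
      at-copy : Δ (x ↑ˡ i) (n ↑ʳ j) (n ↑ʳ j) ≡ adj G x y
      at-copy rewrite inN-old-new x j | inN-self H (n ↑ʳ j) | ℓ =
        trans (xor-comm (nonAdj G y x) true) (trans (not-involutive (adj G y x)) (Graph.sym G y x))
    ... | apex = large-in-H _ (inN-large x) (≤-reflexive (count-cong old-part)) z≤n
      where
      old-part : ∀ w → inN G x w ≡ Δ (x ↑ˡ i) (n ↑ʳ j) (w ↑ˡ i)
      old-part w rewrite inN-old-old x w | inN-new-old j w | ℓ = sym (xor-identityʳ (inN G x w))

    copy-apex-large : ∀ {j j' x} → label j ≡ copy x → label j' ≡ apex →
      Large (Δ (n ↑ʳ j) (n ↑ʳ j'))
    copy-apex-large {j} {j'} {x} ℓ ℓ' with apex⇒all-copies ℓ'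
    ... | pos , pos-copy , pos-count = large-in-H _ (nonAdj+¬inN-large x) (≤-reflexive (count-cong old-part))
                                         (≤-trans (≤-reflexive (count-cong new-part)) (pos-count _))
      where
      old-part : ∀ w → nonAdj G x w ≡ Δ (n ↑ʳ j) (n ↑ʳ j') (w ↑ˡ i)
      old-part w rewrite inN-new-old j w | inN-new-old j' w | ℓ | ℓ' = sym (xor-identityʳ (nonAdj G x w))
      new-part : ∀ y → not (inN G x y) ≡ Δ (n ↑ʳ j) (n ↑ʳ j') (n ↑ʳ pos y)
      new-part y rewrite inN-new-new j (pos y) | inN-new-new j' (pos y) | ℓ | ℓ' | pos-copy y
                       | ⌊≟⌋-copies ℓ (pos-copy y) | ∨-zeroʳ ⌊ j' ≟ pos y ⌋ = sym (xor-comm (inN G x y) true)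

    new-new-large : ∀ {j j'} → j ≢ j' → Large (Δ (n ↑ʳ j) (n ↑ʳ j'))
    new-new-large {j} {j'} j≢j' with label j in ℓ | label j' in ℓ'
    ... | copy x | copy y = large-in-H _ (nonAdj∆nonAdj-large x≢y) (≤-reflexive (count-cong old-part))
                              (subst₂ (λ a b → 𝟙 a + 𝟙 b ≤ count (λ k → Δ (n ↑ʳ j) (n ↑ʳ j') (n ↑ʳ k)))
                                      at-j at-j' (𝟙+𝟙≤count _ j≢j'))
      where
      x≢y : x ≢ y
      x≢y refl = j≢j' (label-injective (trans ℓ (sym ℓ')))
      old-part : ∀ w → (nonAdj G x w xor nonAdj G y w) ≡ Δ (n ↑ʳ j) (n ↑ʳ j') (w ↑ˡ i)
      old-part w rewrite inN-new-old j w | inN-new-old j' w | ℓ | ℓ' = refl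
      at-j : Δ (n ↑ʳ j) (n ↑ʳ j') (n ↑ʳ j) ≡ nonAdj G x y
      at-j rewrite inN-self H (n ↑ʳ j) | inN-new-new j' j | ℓ | ℓ' | ⌊≟⌋-≢ (j≢j' ∘ sym) = cong not (Graph.sym G y x)
      at-j' : Δ (n ↑ʳ j) (n ↑ʳ j') (n ↑ʳ j') ≡ nonAdj G x y
      at-j' rewrite inN-self H (n ↑ʳ j') | inN-new-new j j' | ℓ | ℓ' | ⌊≟⌋-≢ j≢j' = xor-comm (adj G x y) true
    ... | copy _ | apex   = copy-apex-large ℓ ℓ'
    ... | apex   | copy _ = Δ-large-sym (n ↑ʳ j') (n ↑ʳ j) (copy-apex-large ℓ' ℓ)
    ... | apex   | apex   = ⊥-elim (j≢j' (label-injective (trans ℓ (sym ℓ'))))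

    separated-large : ∀ u v → u ≢ v → Large (Δ u v)
    separated-large u v u≢v with view u | view v
    ... | old x | old y  = old-old-large (u≢v ∘ cong (_↑ˡ i))
    ... | old x | new j  = old-new-large x j
    ... | new j | old x  = Δ-large-sym (x ↑ˡ i) (n ↑ʳ j) (old-new-large x j)
    ... | new j | new j' = new-new-large (u≢v ∘ cong (n ↑ʳ_))

    H∈Gr : InGr (n + i) (K + i) H
    H∈Gr = InGr-criterion H (K + i) (≤-trans (≤-trans (s≤s z≤n) 2≤K) (m≤m+n K i)) (+-monoˡ-≤ i K≤n)
             nbhd-large separated-large

module _ {n : ℕ} (G : Graph n) {t λ' μ K : ℕ} (srg : IsStronglyRegular G t λ' μ)
         (k₀≤K : k₀ n t λ' μ ≤ K) (K≤n : K ≤ n) where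

  Gr-extension-≤ : ∀ {i} → i ≤ n → Σ (Graph (n + i)) (InGr (n + i) (K + i))
  Gr-extension-≤ {i} i≤n = H , H∈Gr
    where
    label : Fin i → Added n
    label j = copy (inject≤ j i≤n)
    open Extension G label
    open Identifying srg k₀≤K K≤n (inject≤-injective i≤n i≤n _ _ ∘ copy-injective) (λ ())

  Gr-extension-apex : Σ (Graph (n + suc n)) (InGr (n + suc n) (K + suc n))
  Gr-extension-apex = H , H∈Gr
    where
    label : Fin (suc n) → Added n
    label zero    = apex
    label (suc y) = copy y
    label-injective : ∀ {j j'} → label j ≡ label j' → j ≡ j'
    label-injective {zero}  {zero}  _    = refl
    label-injective {suc _} {suc _} refl = refl
    apex⇒all-copies : ∀ {j} → label j ≡ apex →
      Σ (Fin n → Fin (suc n)) λ pos → (∀ y → label (pos y) ≡ copy y) × (∀ p → count (p ∘ pos) ≤ count p)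
    apex⇒all-copies {zero} _ = suc , (λ _ → refl) , λ p → m≤n+m (count (p ∘ suc)) (𝟙 (p zero))
    open Extension G label
    open Identifying srg k₀≤K K≤n label-injective apex⇒all-copies

theorem26 : (n₀ t λ' μ : ℕ) → SRGExists n₀ t λ' μ → k₀ n₀ t λ' μ ≤ n₀ →
    (i : ℕ) → i ≤ n₀ + 1 → Σ (Graph (n₀ + i)) (InGr (n₀ + i) (k₀ n₀ t λ' μ + i))
theorem26 n₀ t λ' μ (G , srg) k₀≤n₀ i i≤n₀+1 with i ≤? n₀
... | yes i≤n₀ = Gr-extension-≤ G srg ≤-refl k₀≤n₀ i≤n₀
... | no  i≰n₀ rewrite ≤-antisym (subst (i ≤_) (+-comm n₀ 1) i≤n₀+1) (≰⇒> i≰n₀) =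
  Gr-extension-apex G srg ≤-refl k₀≤n₀
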